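{- Let $\mathcal{S}$ be a distributed schema and let $Q$ be a minimal Boolean conjunctive query over $\mathcal{S}$. If a CQ-based d-view $\mathcal{V}$ determines $Q$, then for every source $s$, $\mathcal{V}$ determines the canonical view $\mathrm{CanV}^s(Q)$.
   Context: A distributed schema (d-schema) consists of a finite set of sources, each source $s$ having a local schema $\mathcal{S}_s$ (a finite set of relation names with arities); local schemas are pairwise disjoint. A d-instance is an instance of the union of the local schemas (relations may be finite or infinite); $\mathcal{D}_s$ denotes its restriction to $\mathcal{S}_s$. A d-view $\mathcal{V}$ assigns to each source $s$ a finite set $\mathcal{V}_s$ of views, each view being a query over $\mathcal{S}_s$ only; it is CQ-based if every view is defined by a conjunctive query (CQ). Two d-instances are $\mathcal{V}$-indistinguishable if every view of $\mathcal{V}$ has the same output on them. $\mathcal{V}$ determines a query $Q$ if for all $\mathcal{V}$-indistinguishable d-instances $\mathcal{D},\mathcal{D}'$ (finite or infinite) we have $Q(\mathcal{D})=Q(\mathcal{D}')$. Queries are Boolean CQs without constants. A CQ $Q_0$ is a subquery of $Q$ if its atoms are a subset of those of $Q$ (with the same free variables); $Q$ is minimal if there is no homomorphism from $Q$ to a strict subquery of $Q$. For a CQ $Q$ and source $s$, $\mathrm{SVars}(s,Q)$ is the set of variables of $Q$ occurring in an atom over $\mathcal{S}_s$, and $\mathrm{SJVars}(s,Q)$ is the set of those variables of $\mathrm{SVars}(s,Q)$ that also occur in an atom of another source. The canonical view $\mathrm{CanV}^s(Q)$ is the CQ formed by conjoining all atoms of $Q$ over $\mathcal{S}_s$ and existentially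 quantifying the bound variables of $Q$ in $\mathrm{SVars}(s,Q)\setminus\mathrm{SJVars}(s,Q)$ (so for Boolean $Q$ its free variables are $\mathrm{SJVars}(s,Q)$). -}

module Defs where

open import Data.Nat using (ℕ)
open import Data.Fin using (Fin; _≟_)
open import Data.Vec using (Vec; []; _∷_; fromList) renaming (map to vmap)
open import Data.List using (List; filterᵇ; allFin; length; mapMaybe)
open import Data.Bool.ListAction using (any)
open import Data.List.Membership.Propositional using (_∈_; _∉_)
open import Data.List.Relation.Unary.All using (All)
open import Data.Maybe using (Maybe; just; nothing)
open import Data.Product using (Σ; _×_; _,_; proj₁; proj₂)
open import Data.Bool using (Bool; true; false; _∧_; _∨_; not)
open import Relation.Nullary using (¬_; yes; no)
open import Relation.Nullary.Decidable using (⌊_⌋)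
open import Relation.Binary.PropositionalEquality using (_≡_; refl)
open import Function.Bundles using (_⇔_)

Dom : Set
Dom = ℕ

-- An instance: every relation is an arbitrary (possibly infinite) set of tuples.
Instance : (R : Set) → (R → ℕ) → Set₁
Instance R ar = (r : R) → Vec Dom (ar r) → Set

Atom : (R : Set) → (R → ℕ) → ℕ → Set
Atom R ar n = Σ R (λ r → Vec (Fin n) (ar r))

record CQ (R : Set) (ar : R → ℕ) (k : ℕ) : Set where
  field
    nvars : ℕ
    head  : Vec (Fin nvars) k
    atoms : List (Atom R ar nvars)
open CQ public

⟦_⟧ : {R : Set} {ar : R → ℕ} {k : ℕ} → CQ R ar k → Instance R ar → Vec Dom k → Set
⟦_⟧ {R} {ar} q I t =
  Σ (Fin (nvars q) → Dom) λ ν →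
    (vmap ν (head q) ≡ t) × All (λ a → I (proj₁ a) (vmap ν (proj₂ a))) (atoms q)

renameAtom : {R : Set} {ar : R → ℕ} {n m : ℕ} → (Fin n → Fin m) → Atom R ar n → Atom R ar m
renameAtom h (r , xs) = r , vmap h xs

Minimal : {R : Set} {ar : R → ℕ} {k : ℕ} → CQ R ar k → Set
Minimal {R} {ar} q =
  ¬ (Σ (List (Atom R ar (nvars q))) λ atoms₀ →
       (∀ {a} → a ∈ atoms₀ → a ∈ atoms q)
     × (Σ (Atom R ar (nvars q)) λ a → a ∈ atoms q × a ∉ atoms₀)
     × (Σ (Fin (nvars q) → Fin (nvars q)) λ h →
          (vmap h (head q) ≡ head q)
        × (∀ {a} → a ∈ atoms q → renameAtom h a ∈ atoms₀)))

-- Global relation names are tagged with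
-- their source, so local schemas are pairwise disjoint by construction.

record DSchema : Set where
  field
    nsrc  : ℕ
    nrel  : Fin nsrc → ℕ
    arity : (s : Fin nsrc) → Fin (nrel s) → ℕ
open DSchema public

Source : DSchema → Set
Source S = Fin (nsrc S)

GRel : DSchema → Set
GRel S = Σ (Source S) (λ s → Fin (nrel S s))

garity : (S : DSchema) → GRel S → ℕ
garity S (s , r) = arity S s r

LRel : (S : DSchema) → Source S → Set
LRel S s = Fin (nrel S s)

DInstance : DSchema → Set₁
DInstance S = Instance (GRel S) (garity S)

restrict : {S : DSchema} → DInstance S → (s : Source S) → Instance (LRel S s) (arity S s)
restrict D s r = D (s , r)

DCQ : DSchema → ℕ → Set
DCQ S k = CQ (GRel S) (garity S) k

LocalCQ : (S : DSchema) → Source S → ℕ → Set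
LocalCQ S s k = CQ (LRel S s) (arity S s) k

DView : DSchema → Set
DView S = (s : Source S) → List (Σ ℕ (LocalCQ S s))

Indist : {S : DSchema} → DView S → DInstance S → DInstance S → Set
Indist {S} V D D' =
  (s : Source S) → (v : Σ ℕ (LocalCQ S s)) → v ∈ V s →
  (t : Vec Dom (proj₁ v)) →
  ⟦ proj₂ v ⟧ (restrict D s) t ⇔ ⟦ proj₂ v ⟧ (restrict D' s) t

DQuery : DSchema → ℕ → Set₁
DQuery S k = DInstance S → Vec Dom k → Set

Determines : {S : DSchema} {k : ℕ} → DView S → DQuery S k → Set₁
Determines {S} {k} V q =
  (D D' : DInstance S) → Indist V D D' →
  (t : Vec Dom k) → q D t ⇔ q D' t

evalD : {S : DSchema} {k : ℕ} → DCQ S k → DQuery S k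
evalD q D t = ⟦ q ⟧ D t

module _ (S : DSchema) where

  occursᵇ : {n k : ℕ} → Fin n → Vec (Fin n) k → Bool
  occursᵇ x [] = false
  occursᵇ x (y ∷ ys) = ⌊ x ≟ y ⌋ ∨ occursᵇ x ys

  srcOf : {n : ℕ} → Atom (GRel S) (garity S) n → Source S
  srcOf a = proj₁ (proj₁ a)

  inSVarsᵇ : {k : ℕ} (s : Source S) (Q : DCQ S k) → Fin (nvars Q) → Bool
  inSVarsᵇ s Q x = any (λ a → ⌊ srcOf a ≟ s ⌋ ∧ occursᵇ x (proj₂ a)) (atoms Q)

  inOtherᵇ : {k : ℕ} (s : Source S) (Q : DCQ S k) → Fin (nvars Q) → Bool
  inOtherᵇ s Q x = any (λ a → not ⌊ srcOf a ≟ s ⌋ ∧ occursᵇ x (proj₂ a)) (atoms Q)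

  SJVars : {k : ℕ} (s : Source S) (Q : DCQ S k) → List (Fin (nvars Q))
  SJVars s Q = filterᵇ (λ x → inSVarsᵇ s Q x ∧ inOtherᵇ s Q x) (allFin (nvars Q))

  localise : {n : ℕ} (s : Source S) → Atom (GRel S) (garity S) n → Maybe (Atom (LRel S s) (arity S s) n)
  localise s ((s' , r) , xs) with s' ≟ s
  ... | yes refl = just (r , xs)
  ... | no _ = nothing

  CanV : (s : Source S) (Q : DCQ S 0) → LocalCQ S s (length (SJVars s Q))
  CanV s Q = record
    { nvars = nvars Q
    ; head  = fromList (SJVars s Q)
    ; atoms = mapMaybe (localise s) (atoms Q)
    }

  CanVQuery : (s : Source S) (Q : DCQ S 0) → DQuery S (length (SJVars s Q))
  CanVQuery s Q D t = ⟦ CanV s Q ⟧ (restrict D s) t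

module Submission where

-- Let D, D′ be V-indistinguishable and let ν witness t ∈ CanV^s(Q)(D_s).
-- Expand D to the d-instance that at source s is the product of D with the
-- canonical database of Q (whose values are the variables of Q), and at
-- every other source is the canonical database of Q under the valuation
-- θ x = (ν x , x).  Views are CQs over a single source and CQs commute with
-- products, so the expansions of D and D′ are V-indistinguishable.  θ
-- satisfies Q in the expansion of D; since V determines Q, some μ satisfies
-- Q in the expansion of D′.  The second components of μ form an
-- endomorphism h of Q, and because Q is minimal h has a section g (h ∘ g
-- fixes every atom).  Then fst ∘ μ ∘ g witnesses t ∈ CanV^s(Q)(D′_s): on
-- atoms of source s it lands in D′, and on the join variables it agrees
-- with ν because at the other sources μ factors through θ ∘ h.

open import Defs
open import Axiom.UniquenessOfIdentityProofs using (UIP; module Decidable⇒UIP)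
open import Data.Bool using (Bool; true; false; T; _∧_; if_then_else_)
open import Data.Bool.Properties using (T-≡; T-∧)
open import Data.Empty using (⊥-elim)
open import Data.Fin using (Fin; toℕ; fromℕ<) renaming (_≟_ to _≟F_)
import Data.Fin as Fin
open import Data.Fin.Properties using (pigeonhole; toℕ<n; fromℕ<-toℕ)
open import Data.List using (List; []; _∷_; length; allFin; mapMaybe; filterᵇ)
import Data.List as List
open import Data.List.Membership.DecPropositional using (_∈?_)
open import Data.List.Membership.Propositional using (_∈_; find)
open import Data.List.Membership.Propositional.Properties using (∈-map⁺; ∈-map⁻)
open import Data.List.Relation.Unary.All as All using (All; []; _∷_)
open import Data.List.Relation.Unary.Any using (here; there)
open import Data.List.Relation.Unary.Any.Properties using (any⁻)
open import Data.Maybe using (Maybe; just; nothing)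
open import Data.Nat using (ℕ; zero; suc; _+_; _*_; _∸_; _≤_; _<_; z≤n; pred; _!; _<?_; s≤s⁻¹)
open import Data.Nat.Divisibility using (_∣_; divides; ∣-trans; m∣m*n; m≤n⇒m!∣n!)
open import Data.Nat.GeneralisedArithmetic using (fold; fold-+)
open import Data.Nat.Properties
open import Algebra.Properties.CommutativeSemigroup +-commutativeSemigroup using (x∙yz≈y∙xz)
open import Data.Product using (Σ; _×_; _,_; proj₁; proj₂; uncurry)
open import Data.Product.Properties using (,-injectiveʳ-UIP) renaming (≡-dec to Σ-≡-dec)
open import Data.Sum using (_⊎_; inj₁; inj₂)
open import Data.Vec using (Vec; []; _∷_; fromList; lookup) renaming (map to vmap)
open import Data.Vec.Properties using (map-∘; map-cong; map-id; lookup-map; ∷-injective)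
  renaming (≡-dec to Vec-≡-dec)
open import Function using (_∘_; id)
open import Function.Bundles using (mk⇔; Equivalence)
open import Function.Properties.Equivalence using () renaming (sym to ⇔-sym)
open import Relation.Binary.Definitions using (DecidableEquality)
open import Relation.Binary.PropositionalEquality
open import Relation.Nullary using (yes; no; does)
open import Relation.Nullary.Decidable using (toWitnessFalse)

-- A bijection ℕ × ℕ ≅ ℕ (Cantor pairing).  The product construction below
-- needs to store a pair of data values inside a single data value.

triangle : ℕ → ℕ
triangle zero = 0
triangle (suc k) = suc k + triangle k

pair : ℕ → ℕ → ℕ
pair a b = triangle (a + b) + b

next : ℕ × ℕ → ℕ × ℕ
next (zero , b) = (suc b , 0)
next (suc a , b) = (a , suc b)

unpair : ℕ → ℕ × ℕ
unpair zero = (0 , 0)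
unpair (suc m) = next (unpair m)

fst snd : ℕ → ℕ
fst m = proj₁ (unpair m)
snd m = proj₂ (unpair m)

pair-next : ∀ p → uncurry pair (next p) ≡ suc (uncurry pair p)
pair-next (zero , b)
  rewrite +-identityʳ b | +-identityʳ (suc b + triangle b) = cong suc (+-comm b (triangle b))
pair-next (suc a , b) rewrite +-suc a b = +-suc (triangle (suc (a + b))) b

next-surjective : ∀ p → p ≡ (0 , 0) ⊎ Σ (ℕ × ℕ) (λ p' → next p' ≡ p)
next-surjective (zero , zero) = inj₁ refl
next-surjective (suc a , zero) = inj₂ ((0 , a) , refl)
next-surjective (a , suc b) = inj₂ ((suc a , b) , refl)

pair-fst-snd : ∀ m → pair (fst m) (snd m) ≡ m
pair-fst-snd zero = refl
pair-fst-snd (suc m) = trans (pair-next (unpair m)) (cong suc (pair-fst-snd m))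

unpair-inverse : ∀ m p → uncurry pair p ≡ m → unpair m ≡ p
unpair-inverse m p eq with next-surjective p
unpair-inverse zero _ eq | inj₁ refl = refl
unpair-inverse (suc m) _ () | inj₁ refl
unpair-inverse zero _ eq | inj₂ (p' , refl) with () ← trans (sym (pair-next p')) eq
unpair-inverse (suc m) _ eq | inj₂ (p' , refl) =
  cong next (unpair-inverse m p' (suc-injective (trans (sym (pair-next p')) eq)))

unpair-pair : ∀ a b → unpair (pair a b) ≡ (a , b)
unpair-pair a b = unpair-inverse (pair a b) (a , b) refl

fst-pair : ∀ a b → fst (pair a b) ≡ a
fst-pair a b = cong proj₁ (unpair-pair a b)

snd-pair : ∀ a b → snd (pair a b) ≡ b
snd-pair a b = cong proj₂ (unpair-pair a b)

pairing : {X : Set} → (X → ℕ) → (X → ℕ) → X → ℕ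
pairing f g x = pair (f x) (g x)

module _ {X : Set} (f g : X → ℕ) where

  map-fst-pairing : ∀ {k} (xs : Vec X k) → vmap fst (vmap (pairing f g) xs) ≡ vmap f xs
  map-fst-pairing xs =
    trans (sym (map-∘ fst (pairing f g) xs)) (map-cong (λ x → fst-pair (f x) (g x)) xs)

  map-snd-pairing : ∀ {k} (xs : Vec X k) → vmap snd (vmap (pairing f g) xs) ≡ vmap g xs
  map-snd-pairing xs =
    trans (sym (map-∘ snd (pairing f g) xs)) (map-cong (λ x → snd-pair (f x) (g x)) xs)

  map-pairing : ∀ {k} (xs : Vec X k) (t : Vec ℕ k) →
    vmap f xs ≡ vmap fst t → vmap g xs ≡ vmap snd t → vmap (pairing f g) xs ≡ t
  map-pairing [] [] _ _ = refl
  map-pairing (x ∷ xs) (m ∷ t) eq₁ eq₂ with ∷-injective eq₁ | ∷-injective eq₂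
  ... | fx≡ , eq₁′ | gx≡ , eq₂′ =
    cong₂ _∷_ (trans (cong₂ pair fx≡ gx≡) (pair-fst-snd m)) (map-pairing xs t eq₁′ eq₂′)

-- A CQ holds in I ⊗ J on t iff it holds in I on
-- the first projection of t and in J on the second; consequently
-- indistinguishability for a CQ is preserved by multiplying with J.

module _ {R : Set} {ar : R → ℕ} where

  _⊗_ : Instance R ar → Instance R ar → Instance R ar
  (I ⊗ J) r w = I r (vmap fst w) × J r (vmap snd w)

  ⊗-split : ∀ {k} (q : CQ R ar k) {I J : Instance R ar} t →
    ⟦ q ⟧ (I ⊗ J) t → ⟦ q ⟧ I (vmap fst t) × ⟦ q ⟧ J (vmap snd t)
  ⊗-split q {I} {J} t (ω , hd , sat) =
    (fst ∘ ω , trans (map-∘ fst ω (head q)) (cong (vmap fst) hd) ,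
      All.map (λ {a} → subst (I (proj₁ a)) (sym (map-∘ fst ω (proj₂ a))) ∘ proj₁) sat) ,
    (snd ∘ ω , trans (map-∘ snd ω (head q)) (cong (vmap snd) hd) ,
      All.map (λ {a} → subst (J (proj₁ a)) (sym (map-∘ snd ω (proj₂ a))) ∘ proj₂) sat)

  ⊗-join : ∀ {k} (q : CQ R ar k) {I J : Instance R ar} t →
    ⟦ q ⟧ I (vmap fst t) → ⟦ q ⟧ J (vmap snd t) → ⟦ q ⟧ (I ⊗ J) t
  ⊗-join q {I} {J} t (ω₁ , hd₁ , sat₁) (ω₂ , hd₂ , sat₂) =
    pairing ω₁ ω₂ , map-pairing ω₁ ω₂ (head q) t hd₁ hd₂ ,
    All.tabulate (λ {a} a∈ →
      subst (I (proj₁ a)) (sym (map-fst-pairing ω₁ ω₂ (proj₂ a))) (All.lookup sat₁ a∈) ,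
      subst (J (proj₁ a)) (sym (map-snd-pairing ω₁ ω₂ (proj₂ a))) (All.lookup sat₂ a∈))

  ⊗-congˡ : ∀ {k} (q : CQ R ar k) {I I′ J : Instance R ar} →
    (∀ t → ⟦ q ⟧ I t → ⟦ q ⟧ I′ t) → ∀ t → ⟦ q ⟧ (I ⊗ J) t → ⟦ q ⟧ (I′ ⊗ J) t
  ⊗-congˡ q {I} {I′} {J} I→I′ t sat =
    let (satI , satJ) = ⊗-split q {I} {J} t sat
    in ⊗-join q {I′} {J} t (I→I′ (vmap fst t) satI) satJ

-- Every endofunction h of a finite set Fin n
-- has an idempotent power, namely h^(n!): each orbit enters a cycle after
-- at most n steps, and the length of that cycle divides n!.

power : {A : Set} → (A → A) → ℕ → A → A
power h k x = fold x h k

power-+ : {A : Set} (h : A → A) (j k : ℕ) (x : A) → power h (j + k) x ≡ power h j (power h k x)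
power-+ h j k x = fold-+ x h j

n≤n! : ∀ n → n ≤ n !
n≤n! zero = z≤n
n≤n! (suc n) = m≤m*n (suc n) (n !) {{n !≢0}}

∣-! : ∀ {c n} → 0 < c → c ≤ n → c ∣ n !
∣-! {suc c} _ c≤n = ∣-trans (m∣m*n (c !)) (m≤n⇒m!∣n! c≤n)

module _ {n : ℕ} (h : Fin n → Fin n) where

  record Cycle (x : Fin n) : Set where
    field
      start period : ℕ
      start≤n : start ≤ n
      0<period : 0 < period
      period≤n : period ≤ n
      closes : power h (period + start) x ≡ power h start x

  cycle : ∀ x → Cycle x
  cycle x with pigeonhole (n<1+n n) (λ i → power h (toℕ i) x)
  ... | i , j , i<j , hi≡hj = record
    { start = toℕ i
    ; period = toℕ j ∸ toℕ i
    ; start≤n = s≤s⁻¹ (toℕ<n i)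
    ; 0<period = m<n⇒0<n∸m i<j
    ; period≤n = ≤-trans (m∸n≤m (toℕ j) (toℕ i)) (s≤s⁻¹ (toℕ<n j))
    ; closes = trans (cong (λ k → power h k x) (m∸n+n≡m (<⇒≤ i<j))) (sym hi≡hj)
    }

  module _ {x : Fin n} (C : Cycle x) where
    open Cycle C

    once-around : ∀ d → power h (period + (d + start)) x ≡ power h (d + start) x
    once-around d = begin
      power h (period + (d + start)) x   ≡⟨ cong (λ k → power h k x) (x∙yz≈y∙xz period d start) ⟩
      power h (d + (period + start)) x   ≡⟨ power-+ h d (period + start) x ⟩
      power h d (power h (period + start) x) ≡⟨ cong (power h d) closes ⟩
      power h d (power h start x)        ≡⟨ power-+ h d start x ⟨
      power h (d + start) x              ∎
      where open ≡-Reasoning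

    around : ∀ k d → power h (k * period + (d + start)) x ≡ power h (d + start) x
    around zero d = refl
    around (suc k) d = begin
      power h ((period + kp) + (d + start)) x  ≡⟨ cong (λ m → power h m x) regroup ⟩
      power h (period + ((kp + d) + start)) x  ≡⟨ once-around (kp + d) ⟩
      power h ((kp + d) + start) x             ≡⟨ cong (λ m → power h m x) (+-assoc kp d start) ⟩
      power h (kp + (d + start)) x             ≡⟨ around k d ⟩
      power h (d + start) x                    ∎
      where
      open ≡-Reasoning
      kp : ℕ
      kp = k * period
      regroup : (period + kp) + (d + start) ≡ period + ((kp + d) + start)
      regroup = trans (+-assoc period kp (d + start)) (cong (period +_) (sym (+-assoc kp d start)))

    -- n! is a multiple of the period and is at least the start.
    stable-at-n! : power h (n ! + n !) x ≡ power h (n !) x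
    stable-at-n! with ∣-! 0<period period≤n
    ... | divides k n!≡k*period = begin
      power h (n ! + n !) x                 ≡⟨ cong (λ m → power h (m + n !) x) n!≡k*period ⟩
      power h (k * period + n !) x          ≡⟨ cong (λ m → power h (k * period + m) x) d+start≡n! ⟨
      power h (k * period + (d + start)) x  ≡⟨ around k d ⟩
      power h (d + start) x                 ≡⟨ cong (λ m → power h m x) d+start≡n! ⟩
      power h (n !) x                       ∎
      where
      open ≡-Reasoning
      d : ℕ
      d = n ! ∸ start
      d+start≡n! : d + start ≡ n !
      d+start≡n! = m∸n+n≡m (≤-trans start≤n (n≤n! n))

  power-idempotent : ∀ x → power h (n ! + n !) x ≡ power h (n !) x
  power-idempotent x = stable-at-n! (cycle x)

-- In a minimal CQ every endomorphism h has a
-- section g on the variables that occur in atoms: g is again an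
-- endomorphism and h ∘ g fixes every atom.  (Take the idempotent power
-- e = h^(n!) and g = h^(n!-1); by minimality the image of e is all of Q,
-- and an idempotent map fixes its image.)

module _ {R : Set} {ar : R → ℕ} {k : ℕ} (q : CQ R ar k) where

  record Endo (h : Fin (nvars q) → Fin (nvars q)) : Set where
    field
      fixes-head : vmap h (head q) ≡ head q
      maps-atoms : ∀ {a} → a ∈ atoms q → renameAtom h a ∈ atoms q
  open Endo

  private
    Var : Set
    Var = Fin (nvars q)

  renameAtom-id : (a : Atom R ar (nvars q)) → renameAtom id a ≡ a
  renameAtom-id (r , xs) = cong (r ,_) (map-id xs)

  renameAtom-∘ : (f g : Var → Var) (a : Atom R ar (nvars q)) →
    renameAtom (f ∘ g) a ≡ renameAtom f (renameAtom g a)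
  renameAtom-∘ f g (r , xs) = cong (r ,_) (map-∘ f g xs)

  endo-∘ : ∀ {f g} → Endo f → Endo g → Endo (f ∘ g)
  endo-∘ {f} {g} F G = record
    { fixes-head = trans (map-∘ f g (head q)) (trans (cong (vmap f) (fixes-head G)) (fixes-head F))
    ; maps-atoms = λ {a} a∈ → subst (_∈ atoms q) (sym (renameAtom-∘ f g a)) (maps-atoms F (maps-atoms G a∈))
    }

  endo-power : ∀ {h} → Endo h → ∀ m → Endo (power h m)
  endo-power H zero = record
    { fixes-head = map-id (head q)
    ; maps-atoms = λ {a} a∈ → subst (_∈ atoms q) (sym (renameAtom-id a)) a∈
    }
  endo-power H (suc m) = endo-∘ H (endo-power H m)

  -- In a minimal CQ an idempotent endomorphism e fixes every atom: its
  -- image cannot be a strict subquery, and e fixes its own image.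
  idempotent-endo-fixes : DecidableEquality R → Minimal q → ∀ {e} → Endo e → (∀ x → e (e x) ≡ e x) →
    ∀ {a} → a ∈ atoms q → vmap e (proj₂ a) ≡ proj₂ a
  idempotent-endo-fixes _≟R_ minimal {e} E idem {a} a∈ = ,-injectiveʳ-UIP uip fixes-a
    where
    _≟A_ : DecidableEquality (Atom R ar (nvars q))
    _≟A_ = Σ-≡-dec _≟R_ (Vec-≡-dec _≟F_)
    uip : UIP R
    uip = Decidable⇒UIP.≡-irrelevant _≟R_
    image : List (Atom R ar (nvars q))
    image = List.map (renameAtom e) (atoms q)
    image⊆atoms : ∀ {b} → b ∈ image → b ∈ atoms q
    image⊆atoms b∈ with ∈-map⁻ (renameAtom e) b∈
    ... | c , c∈ , refl = maps-atoms E c∈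
    e-on-image : ∀ c → renameAtom e (renameAtom e c) ≡ renameAtom e c
    e-on-image (r , xs) = cong (r ,_) (trans (sym (map-∘ e e xs)) (map-cong idem xs))
    fixes-a : renameAtom e a ≡ a
    fixes-a with _∈?_ _≟A_ a image
    ... | yes a∈image with ∈-map⁻ (renameAtom e) a∈image
    ...   | c , _ , refl = e-on-image c
    fixes-a | no a∉image =
      ⊥-elim (minimal (image , image⊆atoms , (a , a∈ , a∉image) , e , fixes-head E , ∈-map⁺ (renameAtom e)))

  -- The section lemma: with g = h^(n!-1), h ∘ g = h^(n!) fixes every atom.
  endo-section : DecidableEquality R → Minimal q → ∀ {h} → Endo h →
    Σ (Var → Var) λ g → Endo g × (∀ {a} → a ∈ atoms q → vmap (h ∘ g) (proj₂ a) ≡ proj₂ a)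
  endo-section _≟R_ minimal {h} H = g , endo-power H (pred N) , h∘g-fixes
    where
    N : ℕ
    N = nvars q !
    e g : Var → Var
    e = power h N
    g = power h (pred N)
    h∘g≗e : ∀ x → h (g x) ≡ e x
    h∘g≗e x = cong (λ m → power h m x) (suc-pred N {{nvars q !≢0}})
    e-idempotent : ∀ x → e (e x) ≡ e x
    e-idempotent x = trans (sym (power-+ h N N x)) (power-idempotent h x)
    h∘g-fixes : ∀ {a} → a ∈ atoms q → vmap (h ∘ g) (proj₂ a) ≡ proj₂ a
    h∘g-fixes {a} a∈ = trans (map-cong h∘g≗e (proj₂ a))
      (idempotent-endo-fixes _≟R_ minimal (endo-power H N) e-idempotent a∈)

module _ {X Y : Set} (f : X → Maybe Y) {P : Y → Set} where

  All-mapMaybe⁻ : ∀ xs → All P (mapMaybe f xs) → ∀ {x y} → x ∈ xs → f x ≡ just y → P y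
  All-mapMaybe⁻ (x ∷ xs) all (here refl) fx≡ with f x
  All-mapMaybe⁻ (x ∷ xs) (py ∷ _) (here refl) refl | just _ = py
  All-mapMaybe⁻ (x ∷ xs) all (there x∈) fx≡ with f x
  ... | just _ = All-mapMaybe⁻ xs (All.tail all) x∈ fx≡
  ... | nothing = All-mapMaybe⁻ xs all x∈ fx≡

  All-mapMaybe⁺ : ∀ xs → (∀ {x y} → x ∈ xs → f x ≡ just y → P y) → All P (mapMaybe f xs)
  All-mapMaybe⁺ [] _ = []
  All-mapMaybe⁺ (x ∷ xs) P-all with f x in fx≡
  ... | just y = P-all (here refl) fx≡ ∷ All-mapMaybe⁺ xs (P-all ∘ there)
  ... | nothing = All-mapMaybe⁺ xs (P-all ∘ there)

filter-map-cong : ∀ {X : Set} (p : X → Bool) {f g : X → ℕ} (xs : List X) →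
  (∀ x → T (p x) → f x ≡ g x) →
  vmap f (fromList (filterᵇ p xs)) ≡ vmap g (fromList (filterᵇ p xs))
filter-map-cong p [] _ = refl
filter-map-cong p (x ∷ xs) f≗g with p x in px≡
... | true = cong₂ _∷_ (f≗g x (Equivalence.from T-≡ px≡)) (filter-map-cong p xs f≗g)
... | false = filter-map-cong p xs f≗g

Vec-0-unique : ∀ {X : Set} (xs ys : Vec X 0) → xs ≡ ys
Vec-0-unique [] [] = refl

lookup-cong : ∀ {X Z : Set} {m} {f g : X → Z} (xs : Vec X m) (i : Fin m) →
  vmap f xs ≡ vmap g xs → f (lookup xs i) ≡ g (lookup xs i)
lookup-cong {f = f} {g} xs i eq =
  trans (sym (lookup-map i f xs)) (trans (cong (λ v → lookup v i) eq) (lookup-map i g xs))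

-- Reading a variable back from its number (the default x is never used on
-- numbers of variables).
decodeVar : ∀ {n} → ℕ → Fin n → Fin n
decodeVar {n} m x with m <? n
... | yes m<n = fromℕ< m<n
... | no _ = x

decodeVar-toℕ : ∀ {n} (y x : Fin n) → decodeVar (toℕ y) x ≡ y
decodeVar-toℕ {n} y x with toℕ y <? n
... | yes y<n = fromℕ<-toℕ y y<n
... | no y≮n = ⊥-elim (y≮n (toℕ<n y))

module _ (S : DSchema) where

  occurs-at : ∀ {n m} (x : Fin n) (xs : Vec (Fin n) m) → T (occursᵇ S x xs) → Σ (Fin m) λ i → lookup xs i ≡ x
  occurs-at x (y ∷ ys) occ with x ≟F y
  ... | yes x≡y = Fin.zero , sym x≡y
  ... | no _ = let (i , eq) = occurs-at x ys occ in Fin.suc i , eq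

  localise-sound : ∀ {n} (s : Source S) (a : Atom (GRel S) (garity S) n) {b} →
    localise S s a ≡ just b → a ≡ ((s , proj₁ b) , proj₂ b)
  localise-sound s ((s′ , r) , xs) eq with s′ ≟F s
  localise-sound s ((s′ , r) , xs) refl | yes refl = refl

  localise-here : ∀ {n} (s : Source S) r (xs : Vec (Fin n) (arity S s r)) →
    localise S s ((s , r) , xs) ≡ just (r , xs)
  localise-here s r xs with s ≟F s
  ... | yes refl = refl
  ... | no s≢s = ⊥-elim (s≢s refl)

indist-sym : ∀ {S : DSchema} {V : DView S} (D D′ : DInstance S) → Indist V D D′ → Indist V D′ D
indist-sym D D′ D~D′ s v v∈ t = ⇔-sym (D~D′ s v v∈ t)

module Transfer (S : DSchema) (Q : DCQ S 0) (minimal : Minimal Q)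
                (V : DView S) (V-determines-Q : Determines V (evalD Q)) (s : Source S) where

  private
    Var : Set
    Var = Fin (nvars Q)
    A : List (Atom (GRel S) (garity S) (nvars Q))
    A = atoms Q

  Blend : DInstance S → DInstance S → DInstance S
  Blend E F (s′ , r) v = if does (s′ ≟F s) then E (s′ , r) v else F (s′ , r) v

  blend-intro : ∀ {E F s′ r v} → (s′ ≡ s → E (s′ , r) v) → (s′ ≢ s → F (s′ , r) v) → Blend E F (s′ , r) v
  blend-intro {s′ = s′} at-s elsewhere with s′ ≟F s
  ... | yes s′≡s = at-s s′≡s
  ... | no s′≢s = elsewhere s′≢s

  blend-cases : ∀ {E F s′ r v} → Blend E F (s′ , r) v → (s′ ≡ s × E (s′ , r) v) ⊎ (s′ ≢ s × F (s′ , r) v)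
  blend-cases {s′ = s′} fact with s′ ≟F s
  ... | yes s′≡s = inj₁ (s′≡s , fact)
  ... | no s′≢s = inj₂ (s′≢s , fact)

  -- Views only see one source, so blending in the same F elsewhere and
  -- multiplying with the same J at s preserves indistinguishability.
  blend-⊗-transfer : ∀ E E′ J F → Indist V E E′ → ∀ s₀ (v : Σ ℕ (LocalCQ S s₀)) → v ∈ V s₀ → ∀ t →
    ⟦ proj₂ v ⟧ (restrict (Blend (E ⊗ J) F) s₀) t → ⟦ proj₂ v ⟧ (restrict (Blend (E′ ⊗ J) F) s₀) t
  blend-⊗-transfer E E′ J F E~E′ s₀ v v∈ t with s₀ ≟F s
  ... | yes refl = ⊗-congˡ (proj₂ v) {restrict E s} {restrict E′ s} {restrict J s}
                     (λ t′ → Equivalence.to (E~E′ s v v∈ t′)) t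
  ... | no _ = id

  indist-blend-⊗ : ∀ E E′ J F → Indist V E E′ → Indist V (Blend (E ⊗ J) F) (Blend (E′ ⊗ J) F)
  indist-blend-⊗ E E′ J F E~E′ s₀ v v∈ t =
    mk⇔ (blend-⊗-transfer E E′ J F E~E′ s₀ v v∈ t)
        (blend-⊗-transfer E′ E J F (indist-sym E E′ E~E′) s₀ v v∈ t)

  -- The canonical database of Q with the variables valued by f.
  Image : (Var → ℕ) → DInstance S
  Image f R w = Σ (Vec Var (garity S R)) λ ys → ((R , ys) ∈ A) × (vmap f ys ≡ w)

  module Witness (D D′ : DInstance S) (D~D′ : Indist V D D′) {t : Vec Dom (length (SJVars S s Q))}
                 (ν : Var → ℕ) (ν-head : vmap ν (fromList (SJVars S s Q)) ≡ t)
                 (ν-atoms : All (λ a → D (s , proj₁ a) (vmap ν (proj₂ a))) (mapMaybe (localise S s) A)) where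

    θ : Var → ℕ
    θ = pairing ν toℕ

    Expand : DInstance S → DInstance S
    Expand E = Blend (E ⊗ Image toℕ) (Image θ)

    θ-satisfies : ⟦ Q ⟧ (Expand D) []
    θ-satisfies = θ , Vec-0-unique _ _ , All.tabulate θ-atom
      where
      θ-atom : ∀ {a} → a ∈ A → Expand D (proj₁ a) (vmap θ (proj₂ a))
      θ-atom {(s′ , r) , xs} a∈ = blend-intro {E = D ⊗ Image toℕ} {F = Image θ}
        (λ { refl → subst (D (s , r)) (sym (map-fst-pairing ν toℕ xs))
                        (All-mapMaybe⁻ (localise S s) A ν-atoms a∈ (localise-here S s r xs))
                  , (xs , a∈ , sym (map-snd-pairing ν toℕ xs)) })
        (λ _ → xs , a∈ , refl)

    μ-satisfies : ⟦ Q ⟧ (Expand D′) []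
    μ-satisfies = Equivalence.to
      (V-determines-Q (Expand D) (Expand D′) (indist-blend-⊗ D D′ (Image toℕ) (Image θ) D~D′) []) θ-satisfies

    μ : Var → ℕ
    μ = proj₁ μ-satisfies

    μ-atom : ∀ {s′ r xs} → ((s′ , r) , xs) ∈ A →
      (s′ ≡ s × (D′ ⊗ Image toℕ) (s′ , r) (vmap μ xs)) ⊎ (s′ ≢ s × Image θ (s′ , r) (vmap μ xs))
    μ-atom a∈ = blend-cases {E = D′ ⊗ Image toℕ} {F = Image θ} (All.lookup (proj₂ (proj₂ μ-satisfies)) a∈)

    h : Var → Var
    h x = decodeVar (snd (μ x)) x

    h-reads : ∀ {m} (xs ys : Vec Var m) → vmap toℕ ys ≡ vmap snd (vmap μ xs) → vmap h xs ≡ ys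
    h-reads [] [] _ = refl
    h-reads (x ∷ xs) (y ∷ ys) eq with ∷-injective eq
    ... | y≡ , ys≡ = cong₂ _∷_ (trans (cong (λ m → decodeVar m x) (sym y≡)) (decodeVar-toℕ y x))
                               (h-reads xs ys ys≡)

    h-reads-θ : ∀ {m} (xs ys : Vec Var m) → vmap θ ys ≡ vmap μ xs → vmap h xs ≡ ys
    h-reads-θ xs ys eq = h-reads xs ys (trans (sym (map-snd-pairing ν toℕ ys)) (cong (vmap snd) eq))

    h-endo : Endo Q h
    h-endo = record { fixes-head = Vec-0-unique _ _ ; maps-atoms = maps-atoms }
      where
      maps-atoms : ∀ {a} → a ∈ A → renameAtom h a ∈ A
      maps-atoms {R@(_ , _) , xs} a∈ with μ-atom a∈
      ... | inj₁ (_ , _ , ys , ys∈ , eq) = subst (λ zs → (R , zs) ∈ A) (sym (h-reads xs ys eq)) ys∈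
      ... | inj₂ (_ , ys , ys∈ , eq) = subst (λ zs → (R , zs) ∈ A) (sym (h-reads-θ xs ys eq)) ys∈

    μ-local : ∀ {r xs} → ((s , r) , xs) ∈ A → D′ (s , r) (vmap (fst ∘ μ) xs)
    μ-local {r} {xs} a∈ with μ-atom a∈
    ... | inj₁ (_ , fact , _) = subst (D′ (s , r)) (sym (map-∘ fst μ xs)) fact
    ... | inj₂ (s≢s , _) = ⊥-elim (s≢s refl)

    μ-remote : ∀ {s′ r xs} → ((s′ , r) , xs) ∈ A → s′ ≢ s → vmap (fst ∘ μ) xs ≡ vmap (ν ∘ h) xs
    μ-remote {xs = xs} a∈ s′≢s with μ-atom a∈
    ... | inj₁ (s′≡s , _) = ⊥-elim (s′≢s s′≡s)
    ... | inj₂ (_ , ys , _ , eq) = begin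
      vmap (fst ∘ μ) xs       ≡⟨ map-∘ fst μ xs ⟩
      vmap fst (vmap μ xs)    ≡⟨ cong (vmap fst) eq ⟨
      vmap fst (vmap θ ys)    ≡⟨ map-fst-pairing ν toℕ ys ⟩
      vmap ν ys               ≡⟨ cong (vmap ν) (h-reads-θ xs ys eq) ⟨
      vmap ν (vmap h xs)      ≡⟨ map-∘ ν h xs ⟨
      vmap (ν ∘ h) xs         ∎
      where open ≡-Reasoning

    section : Σ (Var → Var) λ g → Endo Q g × (∀ {a} → a ∈ A → vmap (h ∘ g) (proj₂ a) ≡ proj₂ a)
    section = endo-section Q (Σ-≡-dec _≟F_ _≟F_) minimal h-endo

    g : Var → Var
    g = proj₁ section

    g-endo : Endo Q g
    g-endo = proj₁ (proj₂ section)

    h∘g-fixes : ∀ {a} → a ∈ A → vmap (h ∘ g) (proj₂ a) ≡ proj₂ a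
    h∘g-fixes = proj₂ (proj₂ section)

    ν′ : Var → ℕ
    ν′ = fst ∘ μ ∘ g

    ν′-local : ∀ {r xs} → ((s , r) , xs) ∈ A → D′ (s , r) (vmap ν′ xs)
    ν′-local {r} {xs} a∈ = subst (D′ (s , r)) (sym (map-∘ (fst ∘ μ) g xs))
      (μ-local (Endo.maps-atoms g-endo a∈))

    ν′-remote : ∀ {s′ r xs} → ((s′ , r) , xs) ∈ A → s′ ≢ s → vmap ν′ xs ≡ vmap ν xs
    ν′-remote {xs = xs} a∈ s′≢s = begin
      vmap ((fst ∘ μ) ∘ g) xs      ≡⟨ map-∘ (fst ∘ μ) g xs ⟩
      vmap (fst ∘ μ) (vmap g xs)   ≡⟨ μ-remote (Endo.maps-atoms g-endo a∈) s′≢s ⟩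
      vmap (ν ∘ h) (vmap g xs)     ≡⟨ map-∘ (ν ∘ h) g xs ⟨
      vmap (ν ∘ (h ∘ g)) xs        ≡⟨ map-∘ ν (h ∘ g) xs ⟩
      vmap ν (vmap (h ∘ g) xs)     ≡⟨ cong (vmap ν) (h∘g-fixes a∈) ⟩
      vmap ν xs                    ∎
      where open ≡-Reasoning

    -- ν′ agrees with ν on SJVars(s,Q): such a variable occurs in a remote atom.
    ν′-agrees : ∀ x → T (inSVarsᵇ S s Q x ∧ inOtherᵇ S s Q x) → ν′ x ≡ ν x
    ν′-agrees x in-SJ
      with find (any⁻ _ A (proj₂ (Equivalence.to T-∧ in-SJ)))
    ... | ((s′ , r) , xs) , b∈ , remote-occ
      with Equivalence.to T-∧ remote-occ
    ... | s′≢s , occ with occurs-at S x xs occ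
    ... | i , refl = lookup-cong xs i (ν′-remote b∈ (toWitnessFalse s′≢s))

    result : CanVQuery S s Q D′ t
    result = ν′ ,
      trans (filter-map-cong _ (allFin (nvars Q)) ν′-agrees) ν-head ,
      All-mapMaybe⁺ (localise S s) A (λ {a} a∈ loc≡ →
        ν′-local (subst (_∈ A) (localise-sound S s a loc≡) a∈))

  canV-transfer : ∀ D D′ → Indist V D D′ → ∀ t → CanVQuery S s Q D t → CanVQuery S s Q D′ t
  canV-transfer D D′ D~D′ t (ν , ν-head , ν-atoms) = Witness.result D D′ D~D′ ν ν-head ν-atoms

mainTheorem1 : (S : DSchema) (Q : DCQ S 0) → Minimal Q →
    (V : DView S) → Determines V (evalD Q) →
    (s : Source S) → Determines V (CanVQuery S s Q)
mainTheorem1 S Q minimal V V-determines-Q s D D′ D~D′ t =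
  mk⇔ (canV-transfer D D′ D~D′ t) (canV-transfer D′ D (indist-sym D D′ D~D′) t)
  where open Transfer S Q minimal V V-determines-Q s
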